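{- Let $H$ be a finite hypergraph and let $H_1=(V_1,E_1)$ and $H_2=(V_2,E_2)$ be partition-connected subhypergraphs of $H$ with $V_1\cap V_2\neq\emptyset$. Then $H_1\cup H_2=(V_1\cup V_2,E_1\cup E_2)$ is partition-connected.
   Context: A hypergraph has a finite vertex set and a set of nonempty vertex subsets as edges; a subhypergraph $(V',E')$ of $H=(V,E)$ has $V'\subseteq V$, $E'\subseteq E$ and every edge of $E'$ contained in $V'$. For a hypergraph $(W,F)$ and a partition $\mathcal P$ of $W$ into nonempty parts, $N(\mathcal P)$ is the number of edges of $F$ having vertices in at least two parts of $\mathcal P$. The hypergraph $(W,F)$ is partition-connected if $N(\mathcal P)\ge|\mathcal P|-1$ for every partition $\mathcal P$ of $W$. -}

module Defs where

open import Data.Nat using (ℕ; _≤_; _∸_)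
open import Data.Fin using (Fin; _≟_)
open import Data.Fin.Properties using (any?)
open import Data.Fin.Subset using (Subset; _∈_; _⊆_; _∪_; _∩_; ∣_∣; Nonempty)
open import Data.Fin.Subset.Properties using (_∈?_)
open import Data.Vec using (tabulate)
open import Data.Product using (Σ; ∃; _×_; _,_)
open import Relation.Binary.PropositionalEquality using (_≡_; _≢_)
open import Relation.Nullary using (Dec; yes; no; ¬_; does)
open import Relation.Nullary.Decidable using (_×-dec_; ¬?)
open import Function.Definitions using (Injective)

-- A finite hypergraph: vertex set Fin n, edge set given by an injective
-- family of nonempty vertex subsets indexed by Fin m (so the edges form a set).
record Hypergraph : Set where
  field
    n        : ℕ
    m        : ℕ
    edge     : Fin m → Subset n
    nonempty : ∀ i → Nonempty (edge i)
    distinct : Injective _≡_ _≡_ edge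

module _ (H : Hypergraph) where
  open Hypergraph H

  IsSubhypergraph : Subset n → Subset m → Set
  IsSubhypergraph V′ E′ = ∀ i → i ∈ E′ → edge i ⊆ V′

  -- A partition of W into k nonempty parts, given by a part-labelling
  -- p : Fin n → Fin k whose restriction to W is onto Fin k (labels of
  -- vertices outside W are irrelevant).
  IsPartition : Subset n → (k : ℕ) → (Fin n → Fin k) → Set
  IsPartition W k p = ∀ (j : Fin k) → ∃ λ u → u ∈ W × p u ≡ j

  Crosses : ∀ {k} → (Fin n → Fin k) → Fin m → Set
  Crosses p i = ∃ λ u → ∃ λ v → (u ∈ edge i × v ∈ edge i) × p u ≢ p v

  crosses? : ∀ {k} (p : Fin n → Fin k) (i : Fin m) → Dec (Crosses p i)
  crosses? p i = any? λ u → any? λ v →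
    ((u ∈? edge i) ×-dec (v ∈? edge i)) ×-dec ¬? (p u ≟ p v)

  N : ∀ {k} → Subset m → (Fin n → Fin k) → ℕ
  N F p = ∣ F ∩ tabulate (λ i → does (crosses? p i)) ∣

  PartitionConnected : Subset n → Subset m → Set
  PartitionConnected W F =
    ∀ (k : ℕ) (p : Fin n → Fin k) → IsPartition W k p → k ∸ 1 ≤ N F p

-- For an arbitrary labelling p (not necessarily onto), partition-connectedness
-- of (W, F) still gives N F p ≥ ∣image W p∣ − 1: unused labels can be deleted
-- one by one, which never makes an edge cross.
--
-- Now let p be a partition of V₁ ∪ V₂ into k parts, S the parts met by V₁, and
-- q the labelling obtained from p by merging all parts of S into the part of a
-- vertex x ∈ V₁ ∩ V₂. Every edge of E₁ lies inside V₁, so it crosses q nowhere: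
-- the E₁-edges crossing p and the E₂-edges crossing q are disjoint, and both
-- cross p. Since V₂ meets every part outside S as well as the merged part,
--   k − 1 ≤ (∣S∣ − 1) + (k − ∣S∣) ≤ N E₁ p + N E₂ q ≤ N (E₁ ∪ E₂) p.
module Submission where

open import Data.Fin using (Fin; zero; suc; punchIn; punchOut; _≟_)
open import Data.Fin.Properties using (any?; all?; ¬∀⟶∃¬; punchInᵢ≢i; punchOut-cong; punchOut-punchIn)
open import Data.Fin.Subset using (Subset; _∈_; _∉_; _⊆_; _∪_; _∩_; ∁; ⁅_⁆; ∣_∣; Nonempty; inside; outside)
open import Data.Fin.Subset.Properties using (_∈?_; drop-there; ∣p∣≤n; ∣p∣≤∣x∷p∣; p⊆q⇒∣p∣≤∣q∣; ∣⁅x⁆∣≡1; ∣∁p∣≡n∸∣p∣; x∈⁅y⁆⇒x≡y; x∈∁p⇒x∉p; x∈p∩q⁺; x∈p∩q⁻; x∈p∪q⁺; x∈p∪q⁻)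
open import Data.Nat using (zero; suc; _+_; _∸_; _≤_; z≤n; s≤s)
open import Data.Nat.Properties using (≤-trans; +-suc; +-mono-≤; ∸-monoˡ-≤; m≤n+m∸n; n≤1+n; m+n≤o⇒m≤o∸n; module ≤-Reasoning)
open import Data.Product using (∃; _×_; _,_; proj₁; proj₂)
open import Data.Sum using (_⊎_; inj₁; inj₂)
open import Data.Vec using ([]; _∷_; tabulate; here; there)
open import Data.Vec.Properties using (lookup∘tabulate; []=⇒lookup; lookup⇒[]=)
open import Function using (_∘_)
open import Relation.Binary.PropositionalEquality using (_≡_; refl; sym; trans; cong; subst; subst₂)
open import Relation.Nullary using (yes; no; does; ¬_; contradiction)
open import Relation.Nullary.Decidable using (dec-true; _×-dec_)
open import Relation.Unary using (Pred; Decidable)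

open import Defs

∈-tabulate-does⁺ : ∀ {n p} {P : Pred (Fin n) p} (P? : Decidable P) {j} →
                   P j → j ∈ tabulate (does ∘ P?)
∈-tabulate-does⁺ P? {j} Pj =
  lookup⇒[]= j _ (trans (lookup∘tabulate (does ∘ P?) j) (dec-true (P? j) Pj))

∈-tabulate-does⁻ : ∀ {n p} {P : Pred (Fin n) p} (P? : Decidable P) {j} →
                   j ∈ tabulate (does ∘ P?) → P j
∈-tabulate-does⁻ P? {j} j∈ with P? j | trans (sym (lookup∘tabulate (does ∘ P?) j)) ([]=⇒lookup j∈)
... | yes Pj | _ = Pj
... | no _   | ()

∣p∣+∣q∣≤∣p∪q∣ : ∀ {n} (p q : Subset n) → (∀ {x} → x ∈ p → x ∉ q) → ∣ p ∣ + ∣ q ∣ ≤ ∣ p ∪ q ∣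
∣p∣+∣q∣≤∣p∪q∣ []            []            _    = z≤n
∣p∣+∣q∣≤∣p∪q∣ (outside ∷ p) (outside ∷ q) disj = ∣p∣+∣q∣≤∣p∪q∣ p q (λ x∈p → disj (there x∈p) ∘ there)
∣p∣+∣q∣≤∣p∪q∣ (inside  ∷ p) (outside ∷ q) disj = s≤s (∣p∣+∣q∣≤∣p∪q∣ p q (λ x∈p → disj (there x∈p) ∘ there))
∣p∣+∣q∣≤∣p∪q∣ (outside ∷ p) (inside  ∷ q) disj rewrite +-suc ∣ p ∣ ∣ q ∣ =
  s≤s (∣p∣+∣q∣≤∣p∪q∣ p q (λ x∈p → disj (there x∈p) ∘ there))
∣p∣+∣q∣≤∣p∪q∣ (inside  ∷ p) (inside  ∷ q) disj = contradiction here (disj here)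

x∈p⇒n∸∣p∣+1≤∣∁p∪⁅x⁆∣ : ∀ {n} (p : Subset n) {x} → x ∈ p → n ∸ ∣ p ∣ + 1 ≤ ∣ ∁ p ∪ ⁅ x ⁆ ∣
x∈p⇒n∸∣p∣+1≤∣∁p∪⁅x⁆∣ p {x} x∈p =
  subst₂ (λ a b → a + b ≤ ∣ ∁ p ∪ ⁅ x ⁆ ∣) (∣∁p∣≡n∸∣p∣ p) (∣⁅x⁆∣≡1 x)
    (∣p∣+∣q∣≤∣p∪q∣ (∁ p) ⁅ x ⁆ λ y∈∁p y∈⁅x⁆ → x∈∁p⇒x∉p y∈∁p (subst (_∈ p) (sym (x∈⁅y⁆⇒x≡y x y∈⁅x⁆)) x∈p))

∣p∣≤∣q∣-punchIn : ∀ {k} (j : Fin (suc k)) (p : Subset (suc k)) (q : Subset k) →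
                  j ∉ p → (∀ {l} → punchIn j l ∈ p → l ∈ q) → ∣ p ∣ ≤ ∣ q ∣
∣p∣≤∣q∣-punchIn zero (inside ∷ p) q j∉p _ = contradiction here j∉p
∣p∣≤∣q∣-punchIn zero (outside ∷ p) q _ p⊆q = p⊆q⇒∣p∣≤∣q∣ (p⊆q ∘ there)
∣p∣≤∣q∣-punchIn {suc k} (suc j) (s ∷ p) (t ∷ q) j∉p p⊆q =
  cons s t p⊆q (∣p∣≤∣q∣-punchIn j p q (j∉p ∘ there) (drop-there ∘ p⊆q ∘ there))
  where
  cons : ∀ s t → (zero ∈ s ∷ p → zero ∈ t ∷ q) → ∣ p ∣ ≤ ∣ q ∣ → ∣ s ∷ p ∣ ≤ ∣ t ∷ q ∣
  cons outside t _ ∣p∣≤∣q∣ = ≤-trans ∣p∣≤∣q∣ (∣p∣≤∣x∷p∣ t q)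
  cons inside inside _ ∣p∣≤∣q∣ = s≤s ∣p∣≤∣q∣
  cons inside outside 0∈⇒0∈ _ with 0∈⇒0∈ here
  ... | ()

m∸1≤[n∸1]+[m∸n] : ∀ m n → m ∸ 1 ≤ (n ∸ 1) + (m ∸ n)
m∸1≤[n∸1]+[m∸n] zero    n       = z≤n
m∸1≤[n∸1]+[m∸n] (suc m) zero    = n≤1+n m
m∸1≤[n∸1]+[m∸n] (suc m) (suc n) = m≤n+m∸n m n

-- The value at j itself is junk; it is only ever applied to labels other than j.
removeLabel : ∀ {k} → Fin (suc (suc k)) → Fin (suc (suc k)) → Fin (suc k)
removeLabel j l with j ≟ l
... | yes _  = zero
... | no j≢l = punchOut j≢l

removeLabel-punchIn : ∀ {k} (j : Fin (suc (suc k))) l → removeLabel j (punchIn j l) ≡ l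
removeLabel-punchIn j l with j ≟ punchIn j l
... | yes j≡ = contradiction (sym j≡) (punchInᵢ≢i j l)
... | no _   = trans (punchOut-cong j refl) (punchOut-punchIn j)

collapse : ∀ {k} → Subset k → Fin k → Fin k → Fin k
collapse S c l with l ∈? S
... | yes _ = c
... | no _  = l

collapse-∈ : ∀ {k} {S : Subset k} {c l} → l ∈ S → collapse S c l ≡ c
collapse-∈ {S = S} {l = l} l∈S with l ∈? S
... | yes _  = refl
... | no l∉S = contradiction l∈S l∉S

collapse-∉ : ∀ {k} {S : Subset k} {c l} → l ∉ S → collapse S c l ≡ l
collapse-∉ {S = S} {l = l} l∉S with l ∈? S
... | yes l∈S = contradiction l∈S l∉S
... | no _    = refl

module _ (H : Hypergraph) where
  open Hypergraph H

  crossing : ∀ {k} → (Fin n → Fin k) → Subset m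
  crossing p = tabulate (does ∘ crosses? H p)

  crossing-∘ : ∀ {k k′} (σ : Fin k → Fin k′) (p : Fin n → Fin k) → crossing (σ ∘ p) ⊆ crossing p
  crossing-∘ σ p i∈ with ∈-tabulate-does⁻ (crosses? H (σ ∘ p)) i∈
  ... | u , v , uv∈ , σpu≢σpv = ∈-tabulate-does⁺ (crosses? H p) (u , v , uv∈ , σpu≢σpv ∘ cong σ)

  N-∘-≤ : ∀ {k k′} (σ : Fin k → Fin k′) (p : Fin n → Fin k) F → N H F (σ ∘ p) ≤ N H F p
  N-∘-≤ σ p F = p⊆q⇒∣p∣≤∣q∣ λ i∈ →
    let i∈F , i∈σp = x∈p∩q⁻ F _ i∈ in x∈p∩q⁺ (i∈F , crossing-∘ σ p i∈σp)

  image : ∀ {k} → Subset n → (Fin n → Fin k) → Subset k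
  image W p = tabulate (does ∘ λ j → any? λ u → (u ∈? W) ×-dec (p u ≟ j))

  ∈-image⁺ : ∀ {k W} (p : Fin n → Fin k) {u} → u ∈ W → p u ∈ image W p
  ∈-image⁺ {W = W} p {u} u∈W =
    ∈-tabulate-does⁺ (λ j → any? λ u → (u ∈? W) ×-dec (p u ≟ j)) (u , u∈W , refl)

  ∈-image⁻ : ∀ {k W} {p : Fin n → Fin k} {j} → j ∈ image W p → ∃ λ u → u ∈ W × p u ≡ j
  ∈-image⁻ {W = W} {p} = ∈-tabulate-does⁻ (λ j → any? λ u → (u ∈? W) ×-dec (p u ≟ j))

  ∣image∣≤∣image∘removeLabel∣ : ∀ {k W} {p : Fin n → Fin (suc (suc k))} {j} →
    j ∉ image W p → ∣ image W p ∣ ≤ ∣ image W (removeLabel j ∘ p) ∣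
  ∣image∣≤∣image∘removeLabel∣ {W = W} {p} {j} j∉ = ∣p∣≤∣q∣-punchIn j _ _ j∉ λ {l} l∈ →
    let u , u∈W , pu≡ = ∈-image⁻ l∈ in
    subst (_∈ _) (trans (cong (removeLabel j) pu≡) (removeLabel-punchIn j l)) (∈-image⁺ (removeLabel j ∘ p) u∈W)

  onto⊎missing : ∀ {k} W (p : Fin n → Fin k) → IsPartition H W k p ⊎ ∃ λ j → j ∉ image W p
  onto⊎missing W p with all? (_∈? image W p)
  ... | yes onto = inj₁ (∈-image⁻ ∘ onto)
  ... | no ¬onto = inj₂ (¬∀⟶∃¬ _ _ (_∈? image W p) ¬onto)

  ∣image∣∸1≤N-fewerLabels : ∀ {k} W F → PartitionConnected H W F →
    ((p : Fin n → Fin (suc k)) → ∣ image W p ∣ ∸ 1 ≤ N H F p) →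
    (p : Fin n → Fin (suc (suc k))) → ∣ image W p ∣ ∸ 1 ≤ N H F p
  ∣image∣∸1≤N-fewerLabels W F pc ih p with onto⊎missing W p
  ... | inj₁ onto = ≤-trans (∸-monoˡ-≤ 1 (∣p∣≤n (image W p))) (pc _ p onto)
  ... | inj₂ (j , j∉) = begin
    ∣ image W p ∣ ∸ 1                     ≤⟨ ∸-monoˡ-≤ 1 (∣image∣≤∣image∘removeLabel∣ j∉) ⟩
    ∣ image W (removeLabel j ∘ p) ∣ ∸ 1   ≤⟨ ih (removeLabel j ∘ p) ⟩
    N H F (removeLabel j ∘ p)             ≤⟨ N-∘-≤ (removeLabel j) p F ⟩
    N H F p                               ∎
    where open ≤-Reasoning

  PartitionConnected⇒∣image∣∸1≤N : ∀ {k} W F → PartitionConnected H W F →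
    (p : Fin n → Fin k) → ∣ image W p ∣ ∸ 1 ≤ N H F p
  PartitionConnected⇒∣image∣∸1≤N {zero}        W F pc p = z≤n
  PartitionConnected⇒∣image∣∸1≤N {suc zero}    W F pc p = ≤-trans (∸-monoˡ-≤ 1 (∣p∣≤n (image W p))) z≤n
  PartitionConnected⇒∣image∣∸1≤N {suc (suc k)} W F pc =
    ∣image∣∸1≤N-fewerLabels W F pc (PartitionConnected⇒∣image∣∸1≤N W F pc)

  module _ {k} (V₁ : Subset n) (p : Fin n → Fin k) (x : Fin n) where

    mergeLabels : Fin k → Fin k
    mergeLabels = collapse (image V₁ p) (p x)

    merge : Fin n → Fin k
    merge = mergeLabels ∘ p

    ¬Crosses-merge : ∀ {i} → edge i ⊆ V₁ → ¬ Crosses H merge i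
    ¬Crosses-merge e⊆V₁ (u , v , (u∈e , v∈e) , mu≢mv) =
      mu≢mv (trans (collapse-∈ (∈-image⁺ p (e⊆V₁ u∈e))) (sym (collapse-∈ (∈-image⁺ p (e⊆V₁ v∈e)))))

    N+N[merge]≤N[∪] : ∀ {E₁} E₂ → IsSubhypergraph H V₁ E₁ →
                      N H E₁ p + N H E₂ merge ≤ N H (E₁ ∪ E₂) p
    N+N[merge]≤N[∪] {E₁} E₂ sub₁ =
      ≤-trans (∣p∣+∣q∣≤∣p∪q∣ (E₁ ∩ crossing p) (E₂ ∩ crossing merge) disjoint) (p⊆q⇒∣p∣≤∣q∣ ⊆∪)
      where
      disjoint : ∀ {i} → i ∈ E₁ ∩ crossing p → i ∉ E₂ ∩ crossing merge
      disjoint i∈₁ i∈₂ = ¬Crosses-merge (sub₁ _ (proj₁ (x∈p∩q⁻ E₁ _ i∈₁)))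
                           (∈-tabulate-does⁻ (crosses? H merge) (proj₂ (x∈p∩q⁻ E₂ _ i∈₂)))
      ⊆∪ : E₁ ∩ crossing p ∪ E₂ ∩ crossing merge ⊆ (E₁ ∪ E₂) ∩ crossing p
      ⊆∪ i∈ with x∈p∪q⁻ _ _ i∈
      ... | inj₁ i∈₁ = let i∈E₁ , i∈p = x∈p∩q⁻ E₁ _ i∈₁ in x∈p∩q⁺ (x∈p∪q⁺ (inj₁ i∈E₁) , i∈p)
      ... | inj₂ i∈₂ = let i∈E₂ , i∈q = x∈p∩q⁻ E₂ _ i∈₂ in x∈p∩q⁺ (x∈p∪q⁺ (inj₂ i∈E₂) , crossing-∘ mergeLabels p i∈q)

    ∁image∪⁅px⁆⊆image[merge] : ∀ V₂ → IsPartition H (V₁ ∪ V₂) k p → x ∈ V₁ → x ∈ V₂ →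
                               ∁ (image V₁ p) ∪ ⁅ p x ⁆ ⊆ image V₂ merge
    ∁image∪⁅px⁆⊆image[merge] V₂ part x∈V₁ x∈V₂ {l} l∈ with x∈p∪q⁻ (∁ (image V₁ p)) _ l∈
    ... | inj₂ l∈⁅px⁆ rewrite x∈⁅y⁆⇒x≡y (p x) l∈⁅px⁆ =
      subst (_∈ image V₂ merge) (collapse-∈ (∈-image⁺ p x∈V₁)) (∈-image⁺ merge x∈V₂)
    ... | inj₁ l∈∁ with part l
    ... | u , u∈V₁∪V₂ , pu≡l with x∈p∪q⁻ V₁ V₂ u∈V₁∪V₂
    ...   | inj₁ u∈V₁ = contradiction (subst (_∈ image V₁ p) pu≡l (∈-image⁺ p u∈V₁)) (x∈∁p⇒x∉p l∈∁)
    ...   | inj₂ u∈V₂ = subst (_∈ image V₂ merge)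
                          (trans (cong mergeLabels pu≡l) (collapse-∉ (x∈∁p⇒x∉p l∈∁)))
                          (∈-image⁺ merge u∈V₂)

    k∸∣image∣≤∣image[merge]∣∸1 : ∀ V₂ → IsPartition H (V₁ ∪ V₂) k p → x ∈ V₁ → x ∈ V₂ →
                                 k ∸ ∣ image V₁ p ∣ ≤ ∣ image V₂ merge ∣ ∸ 1
    k∸∣image∣≤∣image[merge]∣∸1 V₂ part x∈V₁ x∈V₂ = m+n≤o⇒m≤o∸n _ (≤-trans
      (x∈p⇒n∸∣p∣+1≤∣∁p∪⁅x⁆∣ (image V₁ p) (∈-image⁺ p x∈V₁))
      (p⊆q⇒∣p∣≤∣q∣ (∁image∪⁅px⁆⊆image[merge] V₂ part x∈V₁ x∈V₂)))

lemma14 : (H : Hypergraph) (V₁ V₂ : Subset (Hypergraph.n H)) (E₁ E₂ : Subset (Hypergraph.m H)) →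
    IsSubhypergraph H V₁ E₁ → IsSubhypergraph H V₂ E₂ →
    PartitionConnected H V₁ E₁ → PartitionConnected H V₂ E₂ →
    Nonempty (V₁ ∩ V₂) →
    PartitionConnected H (V₁ ∪ V₂) (E₁ ∪ E₂)
lemma14 H V₁ V₂ E₁ E₂ sub₁ _ pc₁ pc₂ (x , x∈V₁∩V₂) k p part = begin
  k ∸ 1                         ≤⟨ m∸1≤[n∸1]+[m∸n] k ∣ S ∣ ⟩
  (∣ S ∣ ∸ 1) + (k ∸ ∣ S ∣)     ≤⟨ +-mono-≤ (PartitionConnected⇒∣image∣∸1≤N H V₁ E₁ pc₁ p) parts₂ ⟩
  N H E₁ p + N H E₂ q           ≤⟨ N+N[merge]≤N[∪] H V₁ p x E₂ sub₁ ⟩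
  N H (E₁ ∪ E₂) p               ∎
  where
  open ≤-Reasoning
  S : Subset k
  S = image H V₁ p
  q : Fin (Hypergraph.n H) → Fin k
  q = merge H V₁ p x
  x∈V₁ : x ∈ V₁
  x∈V₁ = proj₁ (x∈p∩q⁻ V₁ V₂ x∈V₁∩V₂)
  x∈V₂ : x ∈ V₂
  x∈V₂ = proj₂ (x∈p∩q⁻ V₁ V₂ x∈V₁∩V₂)
  parts₂ : k ∸ ∣ S ∣ ≤ N H E₂ q
  parts₂ = begin
    k ∸ ∣ S ∣               ≤⟨ k∸∣image∣≤∣image[merge]∣∸1 H V₁ p x V₂ part x∈V₁ x∈V₂ ⟩
    ∣ image H V₂ q ∣ ∸ 1    ≤⟨ PartitionConnected⇒∣image∣∸1≤N H V₂ E₂ pc₂ q ⟩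
    N H E₂ q                ∎
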